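{- Let $Q$ be a quadrilateral in $\mathbb{k}^2$ ($\mathbb{k}$ a field of characteristic $\neq2$) and let $f:\mathbb{k}^2\to\mathbb{k}^2$ be an invertible linear transformation, with $f(Q)$ the quadrilateral whose sides are the images under $f$ of the sides of $Q$ (in the same order). Then there is $\lambda\in\mathbb{k}$ such that $\langle \mathbf v,\mathbf w\rangle_Q=\lambda\langle f(\mathbf v),f(\mathbf w)\rangle_{f(Q)}$ for all $\mathbf v,\mathbf w\in\mathbb{k}^2$. Consequently, lines $\ell_1,\ell_2$ are $Q$-orthogonal if and only if $f(\ell_1),f(\ell_2)$ are $f(Q)$-orthogonal.
   Context: Every line $L$ has an equation $tX-uY+v=0$ normalized so that $t=1$ if $u=0$ and $u=1$ if $u\ne0$; write $t_L,u_L,v_L$. A quadrilateral $Q=ABA'B'$: four distinct lines $A,B,A',B'$, not all concurrent, with adjacent sides ($\{A,B\},\{B,A'\},\{A',B'\},\{B',A\}$) not parallel. $\alpha = t_Au_Bu_{A'}u_{B'} - u_At_Bu_{A'}u_{B'} + u_Au_Bt_{A'}u_{B'} - u_Au_Bu_{A'}t_{B'}$, $\beta = t_Au_Bt_{A'}u_{B'}-u_At_Bu_{A'}t_{B'}$, $\gamma = t_At_Bt_{A'}u_{B'}-t_At_Bu_{A'}t_{B'}+t_Au_Bt_{A'}t_{B'}-u_At_Bt_{A'}t_{B'}$; $\langle \mathbf v,\mathbf w\rangle_Q=\mathbf v^T\begin{pmatrix}\gamma&-\beta\\-\beta&\alpha\end{pmatrix}\mathbf w$. Lines $\ell_1,\ell_2$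 are $Q$-orthogonal if $\langle (u_{\ell_1},t_{\ell_1}),(u_{\ell_2},t_{\ell_2})\rangle_Q=0$. -}

module Defs where

open import Level using (Level; _⊔_) renaming (suc to lsuc)
open import Algebra.Bundles using (CommutativeRing)
open import Data.Product using (_×_; _,_; ∃; proj₁; proj₂)
open import Relation.Nullary using (¬_)
open import Function.Bundles using (_⇔_)

record Field (c ℓ : Level) : Set (lsuc (c ⊔ ℓ)) where
  field
    commutativeRing : CommutativeRing c ℓ
  open CommutativeRing commutativeRing public
  field
    1≉0     : ¬ (1# ≈ 0#)
    inverse : ∀ x → ¬ (x ≈ 0#) → ∃ λ y → x * y ≈ 1#

module Geometry {c ℓ : Level} (F : Field c ℓ) where
  open Field F public

  CharNot2 : Set ℓ
  CharNot2 = (1# + 1#) ≉ 0#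

  Vec2 : Set c
  Vec2 = Carrier × Carrier

  _≈₂_ : Vec2 → Vec2 → Set ℓ
  (x , y) ≈₂ (x' , y') = (x ≈ x') × (y ≈ y')

  record Matrix : Set c where
    constructor mat
    field
      a b c' d : Carrier

  apply : Matrix → Vec2 → Vec2
  apply (mat a b c' d) (x , y) = (a * x + b * y , c' * x + d * y)

  Invertible : Matrix → Set (c ⊔ ℓ)
  Invertible M = ∃ λ N → (∀ p → apply N (apply M p) ≈₂ p) × (∀ p → apply M (apply N p) ≈₂ p)

  -- a line  t X − u Y + v = 0,  normalized: t = 1 if u = 0, u = 1 if u ≠ 0
  record Line : Set (c ⊔ ℓ) where
    constructor line
    field
      t u v  : Carrier
      norm₀  : u ≈ 0# → t ≈ 1#
      norm₁  : u ≉ 0# → u ≈ 1#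
  open Line public

  OnLine : Line → Vec2 → Set ℓ
  OnLine L (x , y) = (t L * x - u L * y + v L) ≈ 0#

  SameLine : Line → Line → Set ℓ
  SameLine L M = (t L ≈ t M) × (u L ≈ u M) × (v L ≈ v M)

  Distinct : Line → Line → Set ℓ
  Distinct L M = ¬ SameLine L M

  Parallel : Line → Line → Set ℓ
  Parallel L M = (t L * u M) ≈ (u L * t M)

  Concurrent4 : Line → Line → Line → Line → Set (c ⊔ ℓ)
  Concurrent4 A B A' B' = ∃ λ p → OnLine A p × OnLine B p × OnLine A' p × OnLine B' p

  record IsQuadrilateral (A B A' B' : Line) : Set (c ⊔ ℓ) where
    field
      dAB   : Distinct A B
      dAA'  : Distinct A A'
      dAB'  : Distinct A B'
      dBA'  : Distinct B A'
      dBB'  : Distinct B B'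
      dA'B' : Distinct A' B'
      notConcurrent : ¬ Concurrent4 A B A' B'
      npAB   : ¬ Parallel A B
      npBA'  : ¬ Parallel B A'
      npA'B' : ¬ Parallel A' B'
      npB'A  : ¬ Parallel B' A

  IsImage : Matrix → Line → Line → Set (c ⊔ ℓ)
  IsImage M L L' = ∀ q → OnLine L' q ⇔ (∃ λ p → OnLine L p × (q ≈₂ apply M p))

  αQ βQ γQ : Line → Line → Line → Line → Carrier
  αQ A B A' B' = t A * u B * u A' * u B' - u A * t B * u A' * u B'
               + u A * u B * t A' * u B' - u A * u B * u A' * t B'
  βQ A B A' B' = t A * u B * t A' * u B' - u A * t B * u A' * t B'
  γQ A B A' B' = t A * t B * t A' * u B' - t A * t B * u A' * t B'
               + t A * u B * t A' * t B' - u A * t B * t A' * t B'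

  ⟪_,_⟫[_,_,_,_] : Vec2 → Vec2 → Line → Line → Line → Line → Carrier
  ⟪ (v₁ , v₂) , (w₁ , w₂) ⟫[ A , B , A' , B' ] =
    let α = αQ A B A' B' ; β = βQ A B A' B' ; γ = γQ A B A' B' in
    v₁ * (γ * w₁ - β * w₂) + v₂ * ((- β) * w₁ + α * w₂)

  dir : Line → Vec2
  dir L = (u L , t L)

  Orthogonal[_,_,_,_] : Line → Line → Line → Line → Line → Line → Set ℓ
  Orthogonal[ A , B , A' , B' ] ℓ₁ ℓ₂ = ⟪ dir ℓ₁ , dir ℓ₂ ⟫[ A , B , A' , B' ] ≈ 0#

{-# OPTIONS --safe #-}
module Submission where

-- Write [p , q] for the determinant of two vectors and a, b, c, d for the
-- direction vectors (u , t) of the four sides.  Then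
--   ⟨ x , y ⟩_Q = [a,c][b,x][d,y] − [a,b][c,x][d,y] − [a,d][b,x][c,y],
-- in which each of a, b, c, d, x, y occurs exactly once per term.  A linear map
-- M multiplies every bracket [M p , M q] by det M, and sends the direction of a
-- line to a nonzero multiple of the direction of its image line (here invertibility
-- is used).  Hence the form of f(Q) at (M x , M y) is a fixed nonzero multiple of
-- the form of Q at (x , y), and orthogonality is preserved.

open import Defs
open import Data.Product using (_×_; _,_; ∃; proj₁; proj₂)
open import Function.Bundles using (_⇔_; mk⇔; Equivalence)
open import Data.Empty using (⊥)
open import Relation.Nullary using (¬_; yes; no)
open import Algebra.Bundles using (CommutativeRing)
open import Data.Nat.Base as ℕ using (zero; suc)
open import Data.Nat.Properties as ℕ using ()
open import Data.Integer.Base as ℤ using (ℤ; +_; -[1+_]; +-*-rawRing)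
open import Data.Integer.Properties as ℤ using ()
open import Data.Sign.Base as Sign using (Sign)
open import Data.Maybe.Base using (Maybe; just; nothing)
import Relation.Binary.PropositionalEquality as ≡
import Algebra.Solver.Ring
import Algebra.Solver.Ring.AlmostCommutativeRing as AlmostCommutativeRing

-- Tactic.RingSolver uses the ring's own elements as coefficients and cannot
-- cancel them without decidable equality; integer coefficients can be compared.
module IntegerCoefficients {c ℓ} (R : CommutativeRing c ℓ) where
  open CommutativeRing R
  open import Relation.Binary.Reasoning.Setoid setoid
  open import Algebra.Properties.Semiring.Mult.TCOptimised semiring using (1+×; ×-homo-+; ×1-homo-*) renaming (_×_ to _×ₙ_)
  open import Algebra.Properties.Ring ring using (-1*x≈-x)
  open import Algebra.Properties.Group +-group using (ε⁻¹≈ε; ⁻¹-involutive)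
  open import Algebra.Properties.AbelianGroup +-abelianGroup using (⁻¹-∙-comm)
  open import Algebra.Properties.CommutativeSemigroup +-commutativeSemigroup using () renaming (interchange to +-interchange)
  open import Algebra.Properties.CommutativeSemigroup *-commutativeSemigroup using () renaming (interchange to *-interchange)

  fromℤ : ℤ → Carrier
  fromℤ (+ n)    = n ×ₙ 1#
  fromℤ -[1+ n ] = - (suc n ×ₙ 1#)

  fromℤ-‿homo : ∀ i → fromℤ (ℤ.- i) ≈ - fromℤ i
  fromℤ-‿homo (+ zero)  = sym ε⁻¹≈ε
  fromℤ-‿homo (+ suc n) = refl
  fromℤ-‿homo -[1+ n ]  = sym (⁻¹-involutive _)

  x+y-[x+z]≈y-z : ∀ x y z → (x + y) - (x + z) ≈ y - z
  x+y-[x+z]≈y-z x y z = begin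
    (x + y) + - (x + z)   ≈⟨ +-congˡ (sym (⁻¹-∙-comm x z)) ⟩
    (x + y) + (- x + - z) ≈⟨ +-interchange x y (- x) (- z) ⟩
    (x - x) + (y - z)     ≈⟨ +-congʳ (-‿inverseʳ x) ⟩
    0# + (y - z)          ≈⟨ +-identityˡ _ ⟩
    y - z                 ∎

  fromℤ-⊖ : ∀ m n → fromℤ (m ℤ.⊖ n) ≈ m ×ₙ 1# - n ×ₙ 1#
  fromℤ-⊖ zero    zero    = sym (-‿inverseʳ 0#)
  fromℤ-⊖ zero    (suc n) = sym (+-identityˡ _)
  fromℤ-⊖ (suc m) zero    = sym (trans (+-congˡ ε⁻¹≈ε) (+-identityʳ _))
  fromℤ-⊖ (suc m) (suc n) rewrite ℤ.[1+m]⊖[1+n]≡m⊖n m n =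
    trans (fromℤ-⊖ m n) (sym (trans (+-cong (1+× m 1#) (-‿cong (1+× n 1#))) (x+y-[x+z]≈y-z 1# (m ×ₙ 1#) (n ×ₙ 1#))))

  fromℤ-+ : ∀ i j → fromℤ (i ℤ.+ j) ≈ fromℤ i + fromℤ j
  fromℤ-+ (+ m)    (+ n)    = ×-homo-+ 1# m n
  fromℤ-+ (+ m)    -[1+ n ] = fromℤ-⊖ m (suc n)
  fromℤ-+ -[1+ m ] (+ n)    = trans (fromℤ-⊖ n (suc m)) (+-comm _ _)
  fromℤ-+ -[1+ m ] -[1+ n ] = begin
    - (suc (suc (m ℕ.+ n)) ×ₙ 1#)          ≈⟨ -‿cong (reflexive (≡.cong (λ k → suc k ×ₙ 1#) (ℕ.+-suc m n))) ⟨
    - ((suc m ℕ.+ suc n) ×ₙ 1#)            ≈⟨ -‿cong (×-homo-+ 1# (suc m) (suc n)) ⟩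
    - (suc m ×ₙ 1# + suc n ×ₙ 1#)           ≈⟨ ⁻¹-∙-comm _ _ ⟨
    - (suc m ×ₙ 1#) + - (suc n ×ₙ 1#)       ∎

  fromSign : Sign → Carrier
  fromSign Sign.+ = 1#
  fromSign Sign.- = - 1#

  fromℤ-sign*abs : ∀ i → fromℤ i ≈ fromSign (ℤ.sign i) * (ℤ.∣ i ∣ ×ₙ 1#)
  fromℤ-sign*abs (+ n)    = sym (*-identityˡ _)
  fromℤ-sign*abs -[1+ n ] = sym (-1*x≈-x _)

  fromℤ-◃ : ∀ s n → fromℤ (s ℤ.◃ n) ≈ fromSign s * (n ×ₙ 1#)
  fromℤ-◃ s      zero    = sym (zeroʳ _)
  fromℤ-◃ Sign.+ (suc n) = sym (*-identityˡ _)
  fromℤ-◃ Sign.- (suc n) = sym (-1*x≈-x _)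

  fromSign-* : ∀ s t → fromSign (s Sign.* t) ≈ fromSign s * fromSign t
  fromSign-* Sign.+ _      = sym (*-identityˡ _)
  fromSign-* Sign.- Sign.+ = sym (*-identityʳ _)
  fromSign-* Sign.- Sign.- = sym (trans (-1*x≈-x _) (⁻¹-involutive _))

  fromℤ-* : ∀ i j → fromℤ (i ℤ.* j) ≈ fromℤ i * fromℤ j
  fromℤ-* i j = begin
    fromℤ (ℤ.sign i Sign.* ℤ.sign j ℤ.◃ ℤ.∣ i ∣ ℕ.* ℤ.∣ j ∣)
      ≈⟨ fromℤ-◃ (ℤ.sign i Sign.* ℤ.sign j) (ℤ.∣ i ∣ ℕ.* ℤ.∣ j ∣) ⟩
    fromSign (ℤ.sign i Sign.* ℤ.sign j) * ((ℤ.∣ i ∣ ℕ.* ℤ.∣ j ∣) ×ₙ 1#)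
      ≈⟨ *-cong (fromSign-* (ℤ.sign i) (ℤ.sign j)) (×1-homo-* ℤ.∣ i ∣ ℤ.∣ j ∣) ⟩
    (fromSign (ℤ.sign i) * fromSign (ℤ.sign j)) * ((ℤ.∣ i ∣ ×ₙ 1#) * (ℤ.∣ j ∣ ×ₙ 1#))
      ≈⟨ *-interchange _ _ _ _ ⟩
    (fromSign (ℤ.sign i) * (ℤ.∣ i ∣ ×ₙ 1#)) * (fromSign (ℤ.sign j) * (ℤ.∣ j ∣ ×ₙ 1#))
      ≈⟨ *-cong (fromℤ-sign*abs i) (fromℤ-sign*abs j) ⟨
    fromℤ i * fromℤ j ∎

  ℤ⟶R : +-*-rawRing AlmostCommutativeRing.-Raw-AlmostCommutative⟶ AlmostCommutativeRing.fromCommutativeRing R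
  ℤ⟶R = record
    { ⟦_⟧ = fromℤ ; +-homo = fromℤ-+ ; *-homo = fromℤ-* ; -‿homo = fromℤ-‿homo
    ; 0-homo = refl ; 1-homo = refl }

  fromℤ-≟ : ∀ i j → Maybe (fromℤ i ≈ fromℤ j)
  fromℤ-≟ i j with i ℤ.≟ j
  ... | yes ≡.refl = just refl
  ... | no _     = nothing

  open Algebra.Solver.Ring +-*-rawRing (AlmostCommutativeRing.fromCommutativeRing R) ℤ⟶R fromℤ-≟ public

module Planar {c ℓ} (F : Field c ℓ) where
  open Geometry F
  open IntegerCoefficients commutativeRing using (solve; _:=_; _:+_; _:*_; _:-_; :-_; con)
  open import Relation.Binary.Reasoning.Setoid setoid

  inverse-cancelˡ : ∀ {k k⁻¹} y → k * k⁻¹ ≈ 1# → k⁻¹ * (k * y) ≈ y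
  inverse-cancelˡ {k} {k⁻¹} y kk⁻¹≈1 = begin
    k⁻¹ * (k * y) ≈⟨ solve 3 (λ k k⁻¹ y → k⁻¹ :* (k :* y) := (k :* k⁻¹) :* y) refl k k⁻¹ y ⟩
    (k * k⁻¹) * y ≈⟨ *-congʳ kk⁻¹≈1 ⟩
    1# * y        ≈⟨ *-identityˡ y ⟩
    y             ∎

  *-cancelˡ-zero : ∀ {x y} → x ≉ 0# → x * y ≈ 0# → y ≈ 0#
  *-cancelˡ-zero {x} {y} x≉0 xy≈0 with inverse x x≉0
  ... | x⁻¹ , xx⁻¹≈1 = begin
    y              ≈⟨ inverse-cancelˡ y xx⁻¹≈1 ⟨
    x⁻¹ * (x * y)  ≈⟨ *-congˡ xy≈0 ⟩
    x⁻¹ * 0#       ≈⟨ zeroʳ x⁻¹ ⟩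
    0#             ∎

  *-nonzero : ∀ {x y} → x ≉ 0# → y ≉ 0# → x * y ≉ 0#
  *-nonzero x≉0 y≉0 xy≈0 = y≉0 (*-cancelˡ-zero x≉0 xy≈0)

  scaling-inverse : ∀ {k} → k ≉ 0# → ∃ λ k⁻¹ → ∀ {x y} → x ≈ k * y → y ≈ k⁻¹ * x
  scaling-inverse {k} k≉0 with inverse k k≉0
  ... | k⁻¹ , kk⁻¹≈1 = k⁻¹ , λ {x} {y} x≈ky → trans (sym (inverse-cancelˡ y kk⁻¹≈1)) (*-congˡ (sym x≈ky))

  scaling-zero⇔ : ∀ {k x y} → k ≉ 0# → x ≈ k * y → y ≈ 0# ⇔ x ≈ 0#
  scaling-zero⇔ {k} k≉0 x≈ky = mk⇔
    (λ y≈0 → trans x≈ky (trans (*-congˡ y≈0) (zeroʳ k)))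
    (λ x≈0 → *-cancelˡ-zero k≉0 (trans (sym x≈ky) x≈0))

  infixr 25 _·_
  infixl 24 _+₂_

  _·_ : Carrier → Vec2 → Vec2
  s · (x₁ , x₂) = (s * x₁ , s * x₂)

  _+₂_ : Vec2 → Vec2 → Vec2
  (x₁ , x₂) +₂ (y₁ , y₂) = (x₁ + y₁ , x₂ + y₂)

  dot : Vec2 → Vec2 → Carrier
  dot (x₁ , x₂) (y₁ , y₂) = x₁ * y₁ + x₂ * y₂

  det₂ : Vec2 → Vec2 → Carrier
  det₂ (x₁ , x₂) (y₁ , y₂) = x₁ * y₂ - x₂ * y₁

  det : Matrix → Carrier
  det (mat a b c′ d) = a * d - b * c′

  applyᵀ : Matrix → Vec2 → Vec2
  applyᵀ (mat a b c′ d) (x₁ , x₂) = (a * x₁ + c′ * x₂ , b * x₁ + d * x₂)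

  1·-sym : ∀ x → x ≈₂ 1# · x
  1·-sym (x₁ , x₂) = sym (*-identityˡ x₁) , sym (*-identityˡ x₂)

  dot-congʳ : ∀ w {x y} → x ≈₂ y → dot w x ≈ dot w y
  dot-congʳ (w₁ , w₂) (x₁≈y₁ , x₂≈y₂) = +-cong (*-congˡ x₁≈y₁) (*-congˡ x₂≈y₂)

  det₂-cong : ∀ {x x′ y y′} → x ≈₂ x′ → y ≈₂ y′ → det₂ x y ≈ det₂ x′ y′
  det₂-cong (x₁≈ , x₂≈) (y₁≈ , y₂≈) = +-cong (*-cong x₁≈ y₂≈) (-‿cong (*-cong x₂≈ y₁≈))

  dot-applyᵀ : ∀ N w z → dot (applyᵀ N w) z ≈ dot w (apply N z)
  dot-applyᵀ (mat a b c′ d) (w₁ , w₂) (z₁ , z₂) =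
    solve 8 (λ a b c′ d w₁ w₂ z₁ z₂ →
      (a :* w₁ :+ c′ :* w₂) :* z₁ :+ (b :* w₁ :+ d :* w₂) :* z₂
      := w₁ :* (a :* z₁ :+ b :* z₂) :+ w₂ :* (c′ :* z₁ :+ d :* z₂)) refl a b c′ d w₁ w₂ z₁ z₂

  det₂-scale : ∀ s r x y → det₂ (s · x) (r · y) ≈ (s * r) * det₂ x y
  det₂-scale s r (x₁ , x₂) (y₁ , y₂) =
    solve 6 (λ s r x₁ x₂ y₁ y₂ → (s :* x₁) :* (r :* y₂) :- (s :* x₂) :* (r :* y₁)
                               := (s :* r) :* (x₁ :* y₂ :- x₂ :* y₁)) refl s r x₁ x₂ y₁ y₂

  det₂-apply : ∀ M x y → det₂ (apply M x) (apply M y) ≈ det M * det₂ x y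
  det₂-apply (mat a b c′ d) (x₁ , x₂) (y₁ , y₂) =
    solve 8 (λ a b c′ d x₁ x₂ y₁ y₂ →
      (a :* x₁ :+ b :* x₂) :* (c′ :* y₁ :+ d :* y₂) :- (c′ :* x₁ :+ d :* x₂) :* (a :* y₁ :+ b :* y₂)
      := (a :* d :- b :* c′) :* (x₁ :* y₂ :- x₂ :* y₁)) refl a b c′ d x₁ x₂ y₁ y₂

  det₂-scale-apply : ∀ {M s r x y x′ y′} → x′ ≈₂ s · apply M x → y′ ≈₂ r · apply M y →
                     det₂ x′ y′ ≈ (s * r) * (det M * det₂ x y)
  det₂-scale-apply {M} {s} {r} {x} {y} x′≈ y′≈ = begin
    det₂ _ _                            ≈⟨ det₂-cong x′≈ y′≈ ⟩
    det₂ (s · apply M x) (r · apply M y) ≈⟨ det₂-scale s r (apply M x) (apply M y) ⟩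
    (s * r) * det₂ (apply M x) (apply M y) ≈⟨ *-congˡ (det₂-apply M x y) ⟩
    (s * r) * (det M * det₂ x y)         ∎

  det-nonzero : ∀ {M N} → (∀ p → apply N (apply M p) ≈₂ p) → det M ≉ 0#
  det-nonzero {M} {N} N∘M≈id detM≈0 = 1≉0 (begin
    1#                    ≈⟨ solve 0 (con (+ 1) := con (+ 1) :* con (+ 1) :- con (+ 0) :* con (+ 0)) refl ⟩
    det₂ e₁ e₂            ≈⟨ det₂-cong (N∘M≈id e₁) (N∘M≈id e₂) ⟨
    det₂ (apply N (apply M e₁)) (apply N (apply M e₂)) ≈⟨ det₂-apply N (apply M e₁) (apply M e₂) ⟩
    det N * det₂ (apply M e₁) (apply M e₂)  ≈⟨ *-congˡ (det₂-apply M e₁ e₂) ⟩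
    det N * (det M * det₂ e₁ e₂)            ≈⟨ *-congˡ (*-congʳ detM≈0) ⟩
    det N * (0# * det₂ e₁ e₂)               ≈⟨ solve 2 (λ x y → x :* (con (+ 0) :* y) := con (+ 0)) refl (det N) (det₂ e₁ e₂) ⟩
    0#                                      ∎)
    where
    e₁ e₂ : Vec2
    e₁ = 1# , 0#
    e₂ = 0# , 1#

  dirDual : Line → Vec2
  dirDual L = (u L , 1# - u L)

  -- The pairing is 1 by the normalisation of L (t = 1 when u = 0, u = 1
  -- otherwise), but without decidable equality only its nonvanishing is provable.
  dot-dirDual-dir≉0 : ∀ L → dot (dirDual L) (dir L) ≉ 0#
  dot-dirDual-dir≉0 L pairing≈0 =
    pairing-at (norm₁ L u≉0) refl
      (solve 1 (λ t → con (+ 1) :* con (+ 1) :+ (con (+ 1) :- con (+ 1)) :* t := con (+ 1)) refl (t L))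
    where
    pairing-at : ∀ {a b} → u L ≈ a → t L ≈ b → a * a + (1# - a) * b ≈ 1# → ⊥
    pairing-at {a} {b} u≈a t≈b value≈1 = 1≉0 (begin
      1#                       ≈⟨ value≈1 ⟨
      a * a + (1# - a) * b     ≈⟨ +-cong (*-cong u≈a u≈a) (*-cong (+-congˡ (-‿cong u≈a)) t≈b) ⟨
      dot (dirDual L) (dir L)  ≈⟨ pairing≈0 ⟩
      0#                       ∎)
    u≉0 : u L ≉ 0#
    u≉0 u≈0 = pairing-at u≈0 (norm₀ L u≈0)
      (solve 0 (con (+ 0) :* con (+ 0) :+ (con (+ 1) :- con (+ 0)) :* con (+ 1) := con (+ 1)) refl)

  dir-nonzero : ∀ L → ¬ dir L ≈₂ (0# , 0#)
  dir-nonzero L (u≈0 , t≈0) = 1≉0 (trans (sym (norm₀ L u≈0)) t≈0)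

  point-on-line : ∀ L → ∃ (OnLine L)
  point-on-line L = (- (v L * s⁻¹)) · (1# - u L , - u L) , (begin
      t L * (- (v L * s⁻¹) * (1# - u L)) - u L * (- (v L * s⁻¹) * - u L) + v L
        ≈⟨ solve 4 (λ t u v s⁻¹ →
             t :* (:- (v :* s⁻¹) :* (con (+ 1) :- u)) :- u :* (:- (v :* s⁻¹) :* :- u) :+ v
             := v :- v :* ((u :* u :+ (con (+ 1) :- u) :* t) :* s⁻¹)) refl (t L) (u L) (v L) s⁻¹ ⟩
      v L - v L * (dot (dirDual L) (dir L) * s⁻¹)  ≈⟨ +-congˡ (-‿cong (*-congˡ ss⁻¹≈1)) ⟩
      v L - v L * 1#                               ≈⟨ solve 1 (λ v → v :- v :* con (+ 1) := con (+ 0)) refl (v L) ⟩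
      0#                                           ∎)
    where
    s⁻¹ = proj₁ (inverse _ (dot-dirDual-dir≉0 L))
    ss⁻¹≈1 = proj₂ (inverse _ (dot-dirDual-dir≉0 L))

  OnLine-+dir : ∀ L p → OnLine L p → OnLine L (p +₂ dir L)
  OnLine-+dir L (p₁ , p₂) onL = trans
    (solve 5 (λ t u v p₁ p₂ → t :* (p₁ :+ u) :- u :* (p₂ :+ t) :+ v := t :* p₁ :- u :* p₂ :+ v)
       refl (t L) (u L) (v L) p₁ p₂)
    onL

  chord-parallel : ∀ M L p δ → OnLine L (apply M p) → OnLine L (apply M (p +₂ δ)) →
                   det₂ (dir L) (apply M δ) ≈ 0#
  chord-parallel (mat a b c′ d) L (p₁ , p₂) (δ₁ , δ₂) onP onP+δ = begin
    u L * (c′ * δ₁ + d * δ₂) - t L * (a * δ₁ + b * δ₂)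
      ≈⟨ solve 11 (λ a b c′ d t u v p₁ p₂ δ₁ δ₂ →
           u :* (c′ :* δ₁ :+ d :* δ₂) :- t :* (a :* δ₁ :+ b :* δ₂)
           := (t :* (a :* p₁ :+ b :* p₂) :- u :* (c′ :* p₁ :+ d :* p₂) :+ v)
              :- (t :* (a :* (p₁ :+ δ₁) :+ b :* (p₂ :+ δ₂)) :- u :* (c′ :* (p₁ :+ δ₁) :+ d :* (p₂ :+ δ₂)) :+ v))
           refl a b c′ d (t L) (u L) (v L) p₁ p₂ δ₁ δ₂ ⟩
    _ - _     ≈⟨ +-cong onP (-‿cong onP+δ) ⟩
    0# - 0#   ≈⟨ -‿inverseʳ 0# ⟩
    0#        ∎

  image-dir-parallel : ∀ {M L L′} → IsImage M L L′ → det₂ (dir L′) (apply M (dir L)) ≈ 0#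
  image-dir-parallel {M} {L} {L′} img = chord-parallel M L′ p (dir L) (onImage p onP) (onImage (p +₂ dir L) (OnLine-+dir L p onP))
    where
    p = proj₁ (point-on-line L)
    onP = proj₂ (point-on-line L)
    onImage : ∀ q → OnLine L q → OnLine L′ (apply M q)
    onImage q onL = Equivalence.from (img (apply M q)) (q , onL , (refl , refl))

  det₂≈0⇒nonzero-multiple : ∀ c x m → dot c m ≉ 0# → ¬ x ≈₂ (0# , 0#) → det₂ x m ≈ 0# →
                            ∃ λ μ → μ ≉ 0# × x ≈₂ μ · m
  det₂≈0⇒nonzero-multiple (c₁ , c₂) (x₁ , x₂) (m₁ , m₂) k≉0 x≉0 det≈0 = μ , μ≉0 , (x₁≈ , x₂≈)
    where
    k = c₁ * m₁ + c₂ * m₂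
    k⁻¹ = proj₁ (inverse k k≉0)
    r = c₁ * x₁ + c₂ * x₂
    μ = r * k⁻¹
    -- (c · m) x = (c · x) m + det₂ x m (c₂ , − c₁)
    solve-for : ∀ {e mᵢ} w → e * k ≈ r * mᵢ + w * det₂ (x₁ , x₂) (m₁ , m₂) → e ≈ μ * mᵢ
    solve-for {e} {mᵢ} w ek≈ = begin
      e                   ≈⟨ inverse-cancelˡ e (proj₂ (inverse k k≉0)) ⟨
      k⁻¹ * (k * e)       ≈⟨ *-congˡ (trans (*-comm k e) ek≈) ⟩
      k⁻¹ * (r * mᵢ + w * det₂ (x₁ , x₂) (m₁ , m₂))  ≈⟨ *-congˡ (+-congˡ (*-congˡ det≈0)) ⟩
      k⁻¹ * (r * mᵢ + w * 0#)  ≈⟨ solve 4 (λ k⁻¹ r mᵢ w → k⁻¹ :* (r :* mᵢ :+ w :* con (+ 0)) := (r :* k⁻¹) :* mᵢ) refl k⁻¹ r mᵢ w ⟩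
      μ * mᵢ              ∎
    x₁≈ : x₁ ≈ μ * m₁
    x₁≈ = solve-for c₂ (solve 6 (λ c₁ c₂ x₁ x₂ m₁ m₂ →
      x₁ :* (c₁ :* m₁ :+ c₂ :* m₂) := (c₁ :* x₁ :+ c₂ :* x₂) :* m₁ :+ c₂ :* (x₁ :* m₂ :- x₂ :* m₁)) refl c₁ c₂ x₁ x₂ m₁ m₂)
    x₂≈ : x₂ ≈ μ * m₂
    x₂≈ = solve-for (- c₁) (solve 6 (λ c₁ c₂ x₁ x₂ m₁ m₂ →
      x₂ :* (c₁ :* m₁ :+ c₂ :* m₂) := (c₁ :* x₁ :+ c₂ :* x₂) :* m₂ :+ (:- c₁) :* (x₁ :* m₂ :- x₂ :* m₁)) refl c₁ c₂ x₁ x₂ m₁ m₂)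
    μ≉0 : μ ≉ 0#
    μ≉0 μ≈0 = x≉0 (vanish m₁ x₁≈ , vanish m₂ x₂≈)
      where
      vanish : ∀ {e} mᵢ → e ≈ μ * mᵢ → e ≈ 0#
      vanish mᵢ e≈μmᵢ = trans e≈μmᵢ (trans (*-congʳ μ≈0) (zeroˡ mᵢ))

  bracketExpr : (ab cx dy ac bx ad cy : Carrier) → Carrier
  bracketExpr ab cx dy ac bx ad cy = ac * bx * dy - ab * cx * dy - ad * bx * cy

  bracketForm : (a b c d x y : Vec2) → Carrier
  bracketForm a b c d x y =
    bracketExpr (det₂ a b) (det₂ c x) (det₂ d y) (det₂ a c) (det₂ b x) (det₂ a d) (det₂ c y)

  ⟪⟫≈bracketForm : ∀ A B A′ B′ x y →
                   ⟪ x , y ⟫[ A , B , A′ , B′ ] ≈ bracketForm (dir A) (dir B) (dir A′) (dir B′) x y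
  ⟪⟫≈bracketForm A B A′ B′ (x₁ , x₂) (y₁ , y₂) =
    solve 12 (λ uA tA uB tB uC tC uD tD x₁ x₂ y₁ y₂ →
      let α = tA :* uB :* uC :* uD :- uA :* tB :* uC :* uD :+ uA :* uB :* tC :* uD :- uA :* uB :* uC :* tD
          β = tA :* uB :* tC :* uD :- uA :* tB :* uC :* tD
          γ = tA :* tB :* tC :* uD :- tA :* tB :* uC :* tD :+ tA :* uB :* tC :* tD :- uA :* tB :* tC :* tD
          [_,_,_,_] = λ p₁ p₂ q₁ q₂ → p₁ :* q₂ :- p₂ :* q₁
      in x₁ :* (γ :* y₁ :- β :* y₂) :+ x₂ :* ((:- β) :* y₁ :+ α :* y₂)
         := [ uA , tA , uC , tC ] :* [ uB , tB , x₁ , x₂ ] :* [ uD , tD , y₁ , y₂ ]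
            :- [ uA , tA , uB , tB ] :* [ uC , tC , x₁ , x₂ ] :* [ uD , tD , y₁ , y₂ ]
            :- [ uA , tA , uD , tD ] :* [ uB , tB , x₁ , x₂ ] :* [ uC , tC , y₁ , y₂ ])
      refl (u A) (t A) (u B) (t B) (u A′) (t A′) (u B′) (t B′) x₁ x₂ y₁ y₂

  bracketExpr-cong : ∀ {ab cx dy ac bx ad cy ab′ cx′ dy′ ac′ bx′ ad′ cy′} →
    ab ≈ ab′ → cx ≈ cx′ → dy ≈ dy′ → ac ≈ ac′ → bx ≈ bx′ → ad ≈ ad′ → cy ≈ cy′ →
    bracketExpr ab cx dy ac bx ad cy ≈ bracketExpr ab′ cx′ dy′ ac′ bx′ ad′ cy′
  bracketExpr-cong ab≈ cx≈ dy≈ ac≈ bx≈ ad≈ cy≈ =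
    +-cong (+-cong (*-cong (*-cong ac≈ bx≈) dy≈) (-‿cong (*-cong (*-cong ab≈ cx≈) dy≈)))
           (-‿cong (*-cong (*-cong ad≈ bx≈) cy≈))

  bracketExpr-scale : ∀ sa sb sc sd sx sy D ab cx dy ac bx ad cy →
    bracketExpr ((sa * sb) * (D * ab)) ((sc * sx) * (D * cx)) ((sd * sy) * (D * dy))
                ((sa * sc) * (D * ac)) ((sb * sx) * (D * bx)) ((sa * sd) * (D * ad)) ((sc * sy) * (D * cy))
    ≈ (sa * sb * sc * sd * D * D * D * (sx * sy)) * bracketExpr ab cx dy ac bx ad cy
  bracketExpr-scale = solve 14 (λ sa sb sc sd sx sy D ab cx dy ac bx ad cy →
    let expr = λ ab cx dy ac bx ad cy → ac :* bx :* dy :- ab :* cx :* dy :- ad :* bx :* cy in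
    expr ((sa :* sb) :* (D :* ab)) ((sc :* sx) :* (D :* cx)) ((sd :* sy) :* (D :* dy))
         ((sa :* sc) :* (D :* ac)) ((sb :* sx) :* (D :* bx)) ((sa :* sd) :* (D :* ad)) ((sc :* sy) :* (D :* cy))
    := (sa :* sb :* sc :* sd :* D :* D :* D :* (sx :* sy)) :* expr ab cx dy ac bx ad cy) refl

  bracketForm-image : ∀ {M sa sb sc sd sx sy a b c d x y a′ b′ c′ d′ x′ y′} →
    a′ ≈₂ sa · apply M a → b′ ≈₂ sb · apply M b → c′ ≈₂ sc · apply M c → d′ ≈₂ sd · apply M d →
    x′ ≈₂ sx · apply M x → y′ ≈₂ sy · apply M y →
    bracketForm a′ b′ c′ d′ x′ y′ ≈ (sa * sb * sc * sd * det M * det M * det M * (sx * sy)) * bracketForm a b c d x y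
  bracketForm-image {M} {sa} {sb} {sc} {sd} {sx} {sy} {a} {b} {c} {d} {x} {y} a≈ b≈ c≈ d≈ x≈ y≈ = trans
    (bracketExpr-cong (det₂-scale-apply {M} a≈ b≈) (det₂-scale-apply {M} c≈ x≈) (det₂-scale-apply {M} d≈ y≈)
                      (det₂-scale-apply {M} a≈ c≈) (det₂-scale-apply {M} b≈ x≈) (det₂-scale-apply {M} a≈ d≈)
                      (det₂-scale-apply {M} c≈ y≈))
    (bracketExpr-scale sa sb sc sd sx sy (det M) _ _ _ _ _ _ _)

  module LinearImage (M N : Matrix) (N∘M≈id : ∀ p → apply N (apply M p) ≈₂ p) where

    image-direction : ∀ L L′ → IsImage M L L′ → ∃ λ μ → μ ≉ 0# × dir L′ ≈₂ μ · apply M (dir L)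
    image-direction L L′ img =
      det₂≈0⇒nonzero-multiple (applyᵀ N (dirDual L)) (dir L′) (apply M (dir L))
        witness≉0 (dir-nonzero L′) (image-dir-parallel {M} {L} {L′} img)
      where
      witness≉0 : dot (applyᵀ N (dirDual L)) (apply M (dir L)) ≉ 0#
      witness≉0 pairing≈0 = dot-dirDual-dir≉0 L (begin
        dot (dirDual L) (dir L)                         ≈⟨ dot-congʳ (dirDual L) (N∘M≈id (dir L)) ⟨
        dot (dirDual L) (apply N (apply M (dir L)))     ≈⟨ dot-applyᵀ N (dirDual L) (apply M (dir L)) ⟨
        dot (applyᵀ N (dirDual L)) (apply M (dir L))    ≈⟨ pairing≈0 ⟩
        0#                                              ∎)

    module Sides (A B A′ B′ fA fB fA′ fB′ : Line)
                 (iA : IsImage M A fA) (iB : IsImage M B fB) (iA′ : IsImage M A′ fA′) (iB′ : IsImage M B′ fB′) where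

      private
        dA = image-direction A fA iA
        dB = image-direction B fB iB
        dA′ = image-direction A′ fA′ iA′
        dB′ = image-direction B′ fB′ iB′
        detM≉0 = det-nonzero {M} {N} N∘M≈id

      κ : Carrier
      κ = proj₁ dA * proj₁ dB * proj₁ dA′ * proj₁ dB′ * det M * det M * det M

      κ≉0 : κ ≉ 0#
      κ≉0 = *-nonzero (*-nonzero (*-nonzero (*-nonzero (*-nonzero (*-nonzero
              (proj₁ (proj₂ dA)) (proj₁ (proj₂ dB))) (proj₁ (proj₂ dA′))) (proj₁ (proj₂ dB′)))
              detM≉0) detM≉0) detM≉0

      ⟪⟫-image : ∀ {s r x y x′ y′} → x′ ≈₂ s · apply M x → y′ ≈₂ r · apply M y →
                 ⟪ x′ , y′ ⟫[ fA , fB , fA′ , fB′ ] ≈ (κ * (s * r)) * ⟪ x , y ⟫[ A , B , A′ , B′ ]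
      ⟪⟫-image {s} {r} {x} {y} {x′} {y′} x≈ y≈ = begin
        ⟪ x′ , y′ ⟫[ fA , fB , fA′ , fB′ ]
          ≈⟨ ⟪⟫≈bracketForm fA fB fA′ fB′ x′ y′ ⟩
        bracketForm (dir fA) (dir fB) (dir fA′) (dir fB′) x′ y′
          ≈⟨ bracketForm-image {M} (proj₂ (proj₂ dA)) (proj₂ (proj₂ dB)) (proj₂ (proj₂ dA′)) (proj₂ (proj₂ dB′)) x≈ y≈ ⟩
        (κ * (s * r)) * bracketForm (dir A) (dir B) (dir A′) (dir B′) x y
          ≈⟨ *-congˡ (⟪⟫≈bracketForm A B A′ B′ x y) ⟨
        (κ * (s * r)) * ⟪ x , y ⟫[ A , B , A′ , B′ ] ∎

proposition2p8 : ∀ {c ℓ} (F : Field c ℓ) → let open Geometry F in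
    CharNot2 →
    (A B A' B' : Line) → IsQuadrilateral A B A' B' →
    (M : Matrix) → Invertible M →
    (fA fB fA' fB' : Line) →
    IsImage M A fA → IsImage M B fB → IsImage M A' fA' → IsImage M B' fB' →
    (∃ λ λ₀ → ∀ v w →
    ⟪ v , w ⟫[ A , B , A' , B' ] ≈ λ₀ * ⟪ apply M v , apply M w ⟫[ fA , fB , fA' , fB' ])
    ×
    (∀ (ℓ₁ ℓ₂ fℓ₁ fℓ₂ : Line) → IsImage M ℓ₁ fℓ₁ → IsImage M ℓ₂ fℓ₂ →
    Orthogonal[ A , B , A' , B' ] ℓ₁ ℓ₂ ⇔ Orthogonal[ fA , fB , fA' , fB' ] fℓ₁ fℓ₂)
proposition2p8 F _ A B A' B' _ M (N , N∘M≈id , _) fA fB fA' fB' iA iB iA' iB' =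
  (proj₁ unscaling , λ v w → proj₂ unscaling (⟪⟫-image (1·-sym (apply M v)) (1·-sym (apply M w)))) ,
  orthogonal⇔
  where
  open Geometry F
  open Planar F
  open LinearImage M N N∘M≈id
  open Sides A B A' B' fA fB fA' fB' iA iB iA' iB'

  unscaling = scaling-inverse (*-nonzero κ≉0 (*-nonzero 1≉0 1≉0))

  orthogonal⇔ : ∀ ℓ₁ ℓ₂ fℓ₁ fℓ₂ → IsImage M ℓ₁ fℓ₁ → IsImage M ℓ₂ fℓ₂ →
                Orthogonal[ A , B , A' , B' ] ℓ₁ ℓ₂ ⇔ Orthogonal[ fA , fB , fA' , fB' ] fℓ₁ fℓ₂
  orthogonal⇔ ℓ₁ ℓ₂ fℓ₁ fℓ₂ i₁ i₂ =
    scaling-zero⇔ (*-nonzero κ≉0 (*-nonzero (proj₁ (proj₂ d₁)) (proj₁ (proj₂ d₂))))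
                  (⟪⟫-image (proj₂ (proj₂ d₁)) (proj₂ (proj₂ d₂)))
    where
    d₁ = image-direction ℓ₁ fℓ₁ i₁
    d₂ = image-direction ℓ₂ fℓ₂ i₂
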